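{- Let $N$ be a set of positive integers. The class of bimonoidal subreducts of commutative involutive residuated pomonoids satisfying $x\leq x^{n}$ for all $n\in N$ is the class of commutative bimonoids axiomatized by the inequalities $x\leq x^{n}$ and $nx\leq x$ for $n\in N$.
   Context: A commutative bimonoid $\langle A,\leq,\cdot,1,+,0\rangle$ is a poset with two commutative monoid operations $\cdot$ (unit $1$) and $+$ (unit $0$), both order preserving, satisfying $x\cdot(y+z)\leq(x\cdot y)+z$. Here $x^{n}$ is the $n$-fold product and $nx$ the $n$-fold sum of $x$. A commutative involutive residuated pomonoid $\langle B,\leq,\cdot,1,\rightarrow,0\rangle$ is a commutative pomonoid with an operation $\rightarrow$ satisfying $x\cdot y\leq z\iff y\leq x\rightarrow z$ and a constant $0$ with $(x\rightarrow 0)\rightarrow 0=x$; setting $\overline{x}=x\rightarrow 0$ and $x+y:=\overline{\overline{x}\cdot\overline{y}}$, its bimonoid reduct is $\langle B,\leq,\cdot,1,+,0\rangle$. A bimonoidal subreduct of $\mathbf{B}$ is a bimonoid that embeds (order embedding preserving $\cdot,1,+,0$) into this reduct. -}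

module Defs where

open import Level using (Level; _⊔_; suc)
open import Data.Nat using (ℕ; zero) renaming (suc to 1+)
open import Data.Product using (_×_)
open import Relation.Binary.Core using (Rel)
open import Relation.Binary.Structures using (IsPartialOrder)
open import Algebra.Core using (Op₂)
open import Algebra.Structures using (IsCommutativeMonoid)

record IsCommPomonoid {a ℓ} {A : Set a} (_≈_ _≤_ : Rel A ℓ) (_∙_ : Op₂ A) (ε : A) : Set (a ⊔ ℓ) where
  field
    isPartialOrder      : IsPartialOrder _≈_ _≤_
    isCommutativeMonoid : IsCommutativeMonoid _≈_ _∙_ ε
    mono                : ∀ {x y u v} → x ≤ y → u ≤ v → (x ∙ u) ≤ (y ∙ v)

record CommBimonoid (a ℓ : Level) : Set (suc (a ⊔ ℓ)) where
  infixl 7 _·_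
  infixl 6 _+_
  infix 4 _≈_ _≤_
  field
    Carrier : Set a
    _≈_     : Rel Carrier ℓ
    _≤_     : Rel Carrier ℓ
    _·_     : Op₂ Carrier
    1#      : Carrier
    _+_     : Op₂ Carrier
    0#      : Carrier
    isPomonoid·  : IsCommPomonoid _≈_ _≤_ _·_ 1#
    isPomonoid+  : IsCommPomonoid _≈_ _≤_ _+_ 0#
    linDistrib   : ∀ x y z → x · (y + z) ≤ (x · y) + z

  _^_ : Carrier → ℕ → Carrier
  x ^ zero = 1#
  x ^ 1+ n = x · (x ^ n)

  _×·_ : ℕ → Carrier → Carrier
  zero ×· x = 0#
  1+ n ×· x = x + (n ×· x)

record CIRPomonoid (b ℓ : Level) : Set (suc (b ⊔ ℓ)) where
  infixl 7 _·_
  infixr 5 _⇒_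
  infix 4 _≈_ _≤_
  field
    Carrier : Set b
    _≈_     : Rel Carrier ℓ
    _≤_     : Rel Carrier ℓ
    _·_     : Op₂ Carrier
    1#      : Carrier
    _⇒_     : Op₂ Carrier
    0#      : Carrier
    isPomonoid  : IsCommPomonoid _≈_ _≤_ _·_ 1#
    residuated₁ : ∀ {x y z} → x · y ≤ z → y ≤ x ⇒ z
    residuated₂ : ∀ {x y z} → y ≤ x ⇒ z → x · y ≤ z
    involutive  : ∀ x → (x ⇒ 0#) ⇒ 0# ≈ x

  ~_ : Carrier → Carrier
  ~ x = x ⇒ 0#

  infixl 6 _+_
  _+_ : Op₂ Carrier
  x + y = ~ (~ x · ~ y)

  _^_ : Carrier → ℕ → Carrier
  x ^ zero = 1#
  x ^ 1+ n = x · (x ^ n)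

record Embedding {a ℓ b ℓ'} (A : CommBimonoid a ℓ) (B : CIRPomonoid b ℓ') : Set (a ⊔ ℓ ⊔ b ⊔ ℓ') where
  private
    module A = CommBimonoid A
    module B = CIRPomonoid B
  field
    f          : A.Carrier → B.Carrier
    orderPres  : ∀ {x y} → x A.≤ y → f x B.≤ f y
    orderRefl  : ∀ {x y} → f x B.≤ f y → x A.≤ y
    pres-·     : ∀ x y → f (x A.· y) B.≈ f x B.· f y
    pres-1     : f A.1# B.≈ B.1#
    pres-+     : ∀ x y → f (x A.+ y) B.≈ f x B.+ f y
    pres-0     : f A.0# B.≈ B.0#

SatisfiesCIRP : ∀ {b ℓ} (N : ℕ → Set) → CIRPomonoid b ℓ → Set (b ⊔ ℓ)
SatisfiesCIRP N B = ∀ n → N n → ∀ x → x ≤ (x ^ n)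
  where open CIRPomonoid B

SatisfiesBimonoid : ∀ {a ℓ} (N : ℕ → Set) → CommBimonoid a ℓ → Set (a ⊔ ℓ)
SatisfiesBimonoid N A = ∀ n → N n → ∀ x → (x ≤ (x ^ n)) × ((n ×· x) ≤ x)
  where open CommBimonoid A

IsSubreductAt : ∀ {a ℓ} (b ℓ' : Level) (N : ℕ → Set) → CommBimonoid a ℓ → Set (a ⊔ ℓ ⊔ suc (b ⊔ ℓ'))
IsSubreductAt b ℓ' N A = Data.Product.Σ (CIRPomonoid b ℓ') (λ B → SatisfiesCIRP N B × Embedding A B)
  where import Data.Product

{-# OPTIONS --safe #-}
module Submission where

-- Soundness: an embedding sends the n-fold sum of x to ~ ((~ f x) ^ n), so the
-- inequation x ≤ xⁿ, used at ~ f x, yields n x ≤ x.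
-- Completeness is phase semantics. Pairs (p , q) of elements of A form a
-- commutative monoid under (· , +) with pole ⊥ = {(p , q) | p ≤ q}, and its
-- predicates, compared through their orthogonals, form a commutative involutive
-- residuated pomonoid. An element c is sent to ⟦ c ⟧ = {(p , q) | p ≤ c + q},
-- which is the orthogonal of (1 , c) and, by linear distributivity, has the
-- same orthogonal as (c , 0); these two descriptions make ⟦_⟧ preserve
-- ·, 1, + and 0. The two inequations of A say exactly that the n-th power of
-- a pair absorbs into it modulo the pole, which gives X ≤ Xⁿ in the phase space.

open import Defs
open import Level using (Level; _⊔_; suc; Lift; lift; lower)
open import Data.Nat using (ℕ; _≥_; zero) renaming (suc to 1+)
open import Data.Product using (_×_; _,_; proj₁; proj₂; ∃₂)
open import Relation.Binary.PropositionalEquality using (_≡_; refl)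
open import Relation.Binary.Core using (Rel)
open import Relation.Binary.Definitions using (_Respects_)
open import Relation.Binary.Structures using (IsPartialOrder; IsEquivalence)
open import Relation.Binary.Bundles using (Poset; Setoid)
open import Relation.Unary using (Pred; _∈_; _⊆_; _≐_)
open import Relation.Unary.Properties using (≐-refl; ≐-sym; ≐-trans)
open import Algebra.Bundles using (CommutativeMonoid)
open import Algebra.Structures using (IsCommutativeMonoid)
import Algebra.Construct.DirectProduct as DirectProduct
import Algebra.Definitions.RawMonoid as RawMonoidDefinitions
import Algebra.Properties.CommutativeSemigroup as CommutativeSemigroupProperties
import Relation.Binary.Reasoning.PartialOrder as ≤-Reasoning
import Relation.Binary.Reasoning.Setoid as ≈-Reasoning

module CIRPomonoidProperties {b ℓ} (B : CIRPomonoid b ℓ) where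
  open CIRPomonoid B
  open IsCommPomonoid isPomonoid
  open IsPartialOrder isPartialOrder using (antisym)
    renaming (refl to ≤-refl; trans to ≤-trans; reflexive to ≤-reflexive)
  open IsCommutativeMonoid isCommutativeMonoid using (identityˡ)
    renaming (sym to ≈-sym; trans to ≈-trans)

  poset : Poset b ℓ ℓ
  poset = record { isPartialOrder = isPartialOrder }

  ~-antitone : ∀ {x y} → x ≤ y → ~ y ≤ ~ x
  ~-antitone x≤y = residuated₁ (≤-trans (mono x≤y ≤-refl) (residuated₂ ≤-refl))

  ~-cong : ∀ {x y} → x ≈ y → ~ x ≈ ~ y
  ~-cong x≈y = antisym (~-antitone (≤-reflexive (≈-sym x≈y))) (~-antitone (≤-reflexive x≈y))

  ~1≈0 : ~ 1# ≈ 0#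
  ~1≈0 = antisym (≤-trans (≤-reflexive (≈-sym (identityˡ _))) (residuated₂ ≤-refl))
                 (residuated₁ (≤-reflexive (identityˡ _)))

  ~0≈1 : ~ 0# ≈ 1#
  ~0≈1 = ≈-trans (~-cong (≈-sym ~1≈0)) (involutive 1#)

  ~[~x^n]≤x : ∀ n → (∀ x → x ≤ x ^ n) → ∀ x → ~ ((~ x) ^ n) ≤ x
  ~[~x^n]≤x n x≤xⁿ x = begin
    ~ ((~ x) ^ n) ≤⟨ ~-antitone (x≤xⁿ (~ x)) ⟩
    ~ ~ x         ≈⟨ involutive x ⟩
    x             ∎
    where open ≤-Reasoning poset

module EmbeddingProperties {a ℓ b ℓ'} {A : CommBimonoid a ℓ} {B : CIRPomonoid b ℓ'}
                           (E : Embedding A B) where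
  private module A = CommBimonoid A
  open CIRPomonoid B
  open CIRPomonoidProperties B
  open Embedding E
  open IsCommutativeMonoid (IsCommPomonoid.isCommutativeMonoid isPomonoid)
    using (∙-congˡ) renaming (trans to ≈-trans)

  f-^ : ∀ n x → f (x A.^ n) ≈ f x ^ n
  f-^ zero     x = pres-1
  f-^ (1+ n) x = ≈-trans (pres-· x (x A.^ n)) (∙-congˡ (f-^ n x))

  ~f-×· : ∀ n x → ~ f (n A.×· x) ≈ (~ f x) ^ n
  ~f-×· zero     x = ≈-trans (~-cong pres-0) ~0≈1
  ~f-×· (1+ n) x = ≈-trans (~-cong (pres-+ x (n A.×· x)))
                      (≈-trans (involutive _) (∙-congˡ (~f-×· n x)))

subreduct⇒satisfies : ∀ {a ℓ b ℓ'} (N : ℕ → Set) (A : CommBimonoid a ℓ) →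
                      IsSubreductAt b ℓ' N A → SatisfiesBimonoid N A
subreduct⇒satisfies N A (B , x≤xⁿ , E) n n∈N x = orderRefl increasing , orderRefl decreasing
  where
  module A = CommBimonoid A
  open CIRPomonoid B
  open CIRPomonoidProperties B
  open EmbeddingProperties E
  open Embedding E
  open ≤-Reasoning poset

  increasing : f x ≤ f (x A.^ n)
  increasing = begin
    f x       ≤⟨ x≤xⁿ n n∈N (f x) ⟩
    f x ^ n   ≈⟨ f-^ n x ⟨
    f (x A.^ n) ∎

  decreasing : f (n A.×· x) ≤ f x
  decreasing = begin
    f (n A.×· x)       ≈⟨ involutive _ ⟨
    ~ ~ f (n A.×· x)   ≈⟨ ~-cong (~f-×· n x) ⟩
    ~ ((~ f x) ^ n)    ≤⟨ ~[~x^n]≤x n (x≤xⁿ n n∈N) (f x) ⟩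
    f x                ∎

module PhaseSpace {c ℓ d} (M : CommutativeMonoid c ℓ)
                  (⊥ : Pred (CommutativeMonoid.Carrier M) (c ⊔ d))
                  (⊥-resp : ⊥ Respects CommutativeMonoid._≈_ M) where
  open CommutativeMonoid M hiding (refl)
  open CommutativeSemigroupProperties commutativeSemigroup using (x∙yz≈y∙xz)

  L : Level
  L = c ⊔ d

  Phase : Set (suc L)
  Phase = Pred Carrier L

  infix 9 _ᗮ
  _ᗮ : Phase → Phase
  (X ᗮ) m = X ⊆ λ x → ⊥ (x ∙ m)

  ᗮ-resp : ∀ X → (X ᗮ) Respects _≈_
  ᗮ-resp X m≈n m∈Xᗮ x∈X = ⊥-resp (∙-congˡ m≈n) (m∈Xᗮ x∈X)

  ᗮ-antitone : ∀ {X Y} → X ⊆ Y → Y ᗮ ⊆ X ᗮ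
  ᗮ-antitone X⊆Y m∈Yᗮ x∈X = m∈Yᗮ (X⊆Y x∈X)

  ᗮ-cong : ∀ {X Y} → X ≐ Y → X ᗮ ≐ Y ᗮ
  ᗮ-cong (X⊆Y , Y⊆X) = ᗮ-antitone Y⊆X , ᗮ-antitone X⊆Y

  ⊆ᗮᗮ : ∀ {X} → X ⊆ X ᗮ ᗮ
  ⊆ᗮᗮ {x = m} m∈X {z} z∈Xᗮ = ⊥-resp (comm m z) (z∈Xᗮ m∈X)

  ᗮᗮᗮ≐ᗮ : ∀ {X} → X ᗮ ᗮ ᗮ ≐ X ᗮ
  ᗮᗮᗮ≐ᗮ = ᗮ-antitone ⊆ᗮᗮ , ⊆ᗮᗮ

  ᗮᗮ-least : ∀ {X Y} → X ⊆ Y ᗮ → X ᗮ ᗮ ⊆ Y ᗮ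
  ᗮᗮ-least X⊆Yᗮ m∈ = proj₁ ᗮᗮᗮ≐ᗮ (ᗮ-antitone (ᗮ-antitone X⊆Yᗮ) m∈)

  infixl 7 _⊗_
  _⊗_ : Phase → Phase → Phase
  (X ⊗ Y) m = ∃₂ λ x y → x ∈ X × y ∈ Y × m ≡ x ∙ y

  [_] : Carrier → Phase
  [ γ ] m = Lift d (m ≡ γ)

  infixr 5 _⊸_
  _⊸_ : Phase → Phase → Phase
  X ⊸ Y = (X ⊗ Y ᗮ) ᗮ

  ⊗ᗮ-curry : ∀ {X Y z y} → z ∈ (X ⊗ Y) ᗮ → y ∈ Y → y ∙ z ∈ X ᗮ
  ⊗ᗮ-curry {z = z} {y} z∈ y∈Y {x} x∈X = ⊥-resp (assoc x y z) (z∈ (x , y , x∈X , y∈Y , refl))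

  ⊗ᗮ-uncurry : ∀ {X Y z} → (∀ {y} → y ∈ Y → y ∙ z ∈ X ᗮ) → z ∈ (X ⊗ Y) ᗮ
  ⊗ᗮ-uncurry {z = z} h (x , y , x∈X , y∈Y , refl) = ⊥-resp (sym (assoc x y z)) (h y∈Y x∈X)

  ⊗-comm-ᗮ : ∀ {X Y} → (X ⊗ Y) ᗮ ⊆ (Y ⊗ X) ᗮ
  ⊗-comm-ᗮ {x = z} z∈ (y , x , y∈Y , x∈X , refl) =
    ⊥-resp (∙-congʳ (comm x y)) (z∈ (x , y , x∈X , y∈Y , refl))

  ⊗-monoˡ-ᗮ : ∀ {X Y U} → Y ᗮ ⊆ X ᗮ → (Y ⊗ U) ᗮ ⊆ (X ⊗ U) ᗮ
  ⊗-monoˡ-ᗮ Yᗮ⊆Xᗮ z∈ = ⊗ᗮ-uncurry λ u∈U → Yᗮ⊆Xᗮ (⊗ᗮ-curry z∈ u∈U)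

  ⊗-mono-ᗮ : ∀ {X Y U V} → Y ᗮ ⊆ X ᗮ → V ᗮ ⊆ U ᗮ → (Y ⊗ V) ᗮ ⊆ (X ⊗ U) ᗮ
  ⊗-mono-ᗮ Yᗮ⊆Xᗮ Vᗮ⊆Uᗮ z∈ =
    ⊗-comm-ᗮ (⊗-monoˡ-ᗮ Vᗮ⊆Uᗮ (⊗-comm-ᗮ (⊗-monoˡ-ᗮ Yᗮ⊆Xᗮ z∈)))

  ⊗-assoc-ᗮ : ∀ {X Y Z} → ((X ⊗ Y) ⊗ Z) ᗮ ≐ (X ⊗ (Y ⊗ Z)) ᗮ
  ⊗-assoc-ᗮ {X} =
    (λ {z} z∈ → ⊗ᗮ-uncurry λ { (y , w , y∈Y , w∈Z , refl) →
       ᗮ-resp X (sym (assoc y w z)) (⊗ᗮ-curry (⊗ᗮ-curry z∈ w∈Z) y∈Y) }) ,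
    (λ {z} z∈ → ⊗ᗮ-uncurry λ {w} w∈Z → ⊗ᗮ-uncurry λ {y} y∈Y →
       ᗮ-resp X (assoc y w z) (⊗ᗮ-curry z∈ (y , w , y∈Y , w∈Z , refl)))

  ⊗-identityˡ-ᗮ : ∀ {X} → ([ ε ] ⊗ X) ᗮ ≐ X ᗮ
  ⊗-identityˡ-ᗮ =
    (λ {z} z∈ {x} x∈X → ⊥-resp (identityˡ (x ∙ z)) (⊗ᗮ-curry z∈ x∈X (lift refl))) ,
    (λ z∈ → ⊗ᗮ-uncurry λ x∈X → λ { (lift refl) → ⊥-resp (sym (identityˡ _)) (z∈ x∈X) })

  ∙-rearrange : ∀ x y z → (x ∙ y) ∙ z ≈ y ∙ (x ∙ z)
  ∙-rearrange x y z = trans (assoc x y z) (x∙yz≈y∙xz x y z)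

  ⊸-residual₁ : ∀ {X Y Z} → Z ᗮ ⊆ (X ⊗ Y) ᗮ → (X ⊸ Z) ᗮ ⊆ Y ᗮ
  ⊸-residual₁ h = ᗮᗮ-least λ { (x , z , x∈X , z∈Zᗮ , refl) {y} y∈Y →
    ⊥-resp (∙-rearrange x y z) (h z∈Zᗮ (x , y , x∈X , y∈Y , refl)) }

  ⊸-residual₂ : ∀ {X Y Z} → (X ⊸ Z) ᗮ ⊆ Y ᗮ → Z ᗮ ⊆ (X ⊗ Y) ᗮ
  ⊸-residual₂ {X} {Z = Z} h {z} z∈Zᗮ (x , y , x∈X , y∈Y , refl) =
    ⊥-resp (sym (∙-rearrange x y z)) (h (⊆ᗮᗮ {X ⊗ Z ᗮ} (x , z , x∈X , z∈Zᗮ , refl)) y∈Y)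

  ε∈⊥ᗮ : ε ∈ ⊥ ᗮ
  ε∈⊥ᗮ {d} d∈⊥ = ⊥-resp (sym (identityʳ d)) d∈⊥

  ⊸⊥≐ᗮ : ∀ {X} → X ⊸ ⊥ ≐ X ᗮ
  ⊸⊥≐ᗮ =
    (λ {z} z∈ {x} x∈X → ⊥-resp (∙-congʳ (identityʳ x)) (z∈ (x , ε , x∈X , ε∈⊥ᗮ , refl))) ,
    (λ {z} z∈ → ⊗ᗮ-uncurry λ {e} e∈⊥ᗮ {x} x∈X →
       ⊥-resp (trans (assoc x z e) (∙-congˡ (comm z e))) (e∈⊥ᗮ (z∈ x∈X)))

  -- Predicates with the same orthogonal (equivalently, the same closure ᗮᗮ)
  -- are identified: this setoid stands in for the lattice of closed sets.
  infix 4 _≤ᴾ_ _≈ᴾ_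
  _≤ᴾ_ : Rel Phase (suc L)
  X ≤ᴾ Y = Lift (suc L) (Y ᗮ ⊆ X ᗮ)

  _≈ᴾ_ : Rel Phase (suc L)
  X ≈ᴾ Y = Lift (suc L) (X ᗮ ≐ Y ᗮ)

  ≈ᴾ-isEquivalence : IsEquivalence _≈ᴾ_
  ≈ᴾ-isEquivalence = record
    { refl  = lift ≐-refl
    ; sym   = λ (lift e) → lift (≐-sym e)
    ; trans = λ (lift e) (lift e′) → lift (≐-trans e e′)
    }

  ≈ᴾ-setoid : Setoid (suc L) (suc L)
  ≈ᴾ-setoid = record { isEquivalence = ≈ᴾ-isEquivalence }

  ≤ᴾ-isPartialOrder : IsPartialOrder _≈ᴾ_ _≤ᴾ_
  ≤ᴾ-isPartialOrder = record
    { isPreorder = record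
      { isEquivalence = ≈ᴾ-isEquivalence
      ; reflexive     = λ (lift e) → lift (proj₂ e)
      ; trans         = λ (lift p) (lift q) → lift (λ z∈ → p (q z∈))
      }
    ; antisym = λ (lift p) (lift q) → lift (q , p)
    }

  ⊗-isCommutativeMonoid : IsCommutativeMonoid _≈ᴾ_ _⊗_ [ ε ]
  ⊗-isCommutativeMonoid = record
    { isMonoid = record
      { isSemigroup = record
        { isMagma = record
          { isEquivalence = ≈ᴾ-isEquivalence
          ; ∙-cong = λ (lift (p , q)) (lift (p′ , q′)) → lift (⊗-mono-ᗮ p p′ , ⊗-mono-ᗮ q q′)
          }
        ; assoc = λ _ _ _ → lift ⊗-assoc-ᗮ
        }
      ; identity = (λ _ → lift ⊗-identityˡ-ᗮ)
                 , (λ _ → lift (≐-trans (⊗-comm-ᗮ , ⊗-comm-ᗮ) ⊗-identityˡ-ᗮ))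
      }
    ; comm = λ _ _ → lift (⊗-comm-ᗮ , ⊗-comm-ᗮ)
    }

  phaseSpace : CIRPomonoid (suc L) (suc L)
  phaseSpace = record
    { Carrier = Phase ; _≈_ = _≈ᴾ_ ; _≤_ = _≤ᴾ_
    ; _·_ = _⊗_ ; 1# = [ ε ] ; _⇒_ = _⊸_ ; 0# = ⊥
    ; isPomonoid = record
      { isPartialOrder      = ≤ᴾ-isPartialOrder
      ; isCommutativeMonoid = ⊗-isCommutativeMonoid
      ; mono                = λ (lift p) (lift q) → lift (⊗-mono-ᗮ p q)
      }
    ; residuated₁ = λ (lift h) → lift (⊸-residual₁ h)
    ; residuated₂ = λ (lift h) → lift (⊸-residual₂ h)
    ; involutive  = λ _ → lift (≐-trans (ᗮ-cong (≐-trans ⊸⊥≐ᗮ (ᗮ-cong ⊸⊥≐ᗮ))) ᗮᗮᗮ≐ᗮ)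
    }

  open CIRPomonoid phaseSpace using (_^_)
  open RawMonoidDefinitions rawMonoid using () renaming (_×_ to _×ᴹ_)

  ×ᴹ-∈-^ : ∀ {X x} n → x ∈ X → n ×ᴹ x ∈ X ^ n
  ×ᴹ-∈-^ zero     x∈X = lift refl
  ×ᴹ-∈-^ (1+ n) x∈X = _ , _ , x∈X , ×ᴹ-∈-^ n x∈X , refl

  ^-increasing : ∀ n → (∀ x z → ⊥ (n ×ᴹ x ∙ z) → ⊥ (x ∙ z)) → ∀ X → X ≤ᴾ X ^ n
  ^-increasing n ⊥-decreasing X = lift λ z∈ x∈X → ⊥-decreasing _ _ (z∈ (×ᴹ-∈-^ n x∈X))

  ≐⇒≈ᴾ : ∀ {X Y} → X ≐ Y → X ≈ᴾ Y
  ≐⇒≈ᴾ X≐Y = lift (ᗮ-cong X≐Y)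

  ᗮ-congᴾ : ∀ {X Y} → X ≈ᴾ Y → X ᗮ ≈ᴾ Y ᗮ
  ᗮ-congᴾ (lift e) = lift (ᗮ-cong e)

  ⊸⊥≈ᴾᗮ : ∀ {X} → X ⊸ ⊥ ≈ᴾ X ᗮ
  ⊸⊥≈ᴾᗮ = ≐⇒≈ᴾ ⊸⊥≐ᗮ

  ᗮᗮ≈ᴾ : ∀ {X} → X ᗮ ᗮ ≈ᴾ X
  ᗮᗮ≈ᴾ = lift ᗮᗮᗮ≐ᗮ

  []ᗮ-cong : ∀ {γ δ} → γ ≈ δ → [ γ ] ᗮ ⊆ [ δ ] ᗮ
  []ᗮ-cong γ≈δ m∈ (lift refl) = ⊥-resp (∙-congʳ γ≈δ) (m∈ (lift refl))

  []-cong : ∀ {γ δ} → γ ≈ δ → [ γ ] ≈ᴾ [ δ ]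
  []-cong γ≈δ = lift ([]ᗮ-cong γ≈δ , []ᗮ-cong (sym γ≈δ))

  []-⊗ : ∀ {γ δ} → [ γ ] ⊗ [ δ ] ≈ᴾ [ γ ∙ δ ]
  []-⊗ = ≐⇒≈ᴾ ((λ { (_ , _ , lift refl , lift refl , refl) → lift refl })
              , (λ { (lift refl) → _ , _ , lift refl , lift refl , refl }))

module BimonoidPhaseSpace {a ℓ} (A : CommBimonoid a ℓ) where
  open CommBimonoid A
  private
    module · = IsCommPomonoid isPomonoid·
    module + = IsCommPomonoid isPomonoid+
    module ·M = IsCommutativeMonoid ·.isCommutativeMonoid
    module +M = IsCommutativeMonoid +.isCommutativeMonoid
  open IsPartialOrder ·.isPartialOrder using ()
    renaming (refl to ≤-refl; trans to ≤-trans; reflexive to ≤-reflexive)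

  poset : Poset a ℓ ℓ
  poset = record { isPartialOrder = ·.isPartialOrder }

  cut : ∀ {p c q r s} → p ≤ c + q → c · r ≤ s → p · r ≤ q + s
  cut {p} {c} {q} {r} {s} p≤c+q c·r≤s = begin
    p · r       ≤⟨ ·.mono p≤c+q ≤-refl ⟩
    (c + q) · r ≈⟨ ·M.comm _ _ ⟩
    r · (c + q) ≤⟨ linDistrib r c q ⟩
    r · c + q   ≈⟨ +M.∙-congʳ (·M.comm r c) ⟩
    c · r + q   ≤⟨ +.mono c·r≤s ≤-refl ⟩
    s + q       ≈⟨ +M.comm s q ⟩
    q + s       ∎
    where open ≤-Reasoning poset

  pairs : CommutativeMonoid a ℓ
  pairs = DirectProduct.commutativeMonoid
    (record { Carrier = Carrier ; _≈_ = _≈_ ; _∙_ = _·_ ; ε = 1# ; isCommutativeMonoid = ·.isCommutativeMonoid })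
    (record { Carrier = Carrier ; _≈_ = _≈_ ; _∙_ = _+_ ; ε = 0# ; isCommutativeMonoid = +.isCommutativeMonoid })

  open CommutativeMonoid pairs using (rawMonoid) renaming (_∙_ to _∙ᴹ_)
  open RawMonoidDefinitions rawMonoid using () renaming (_×_ to _×ᴹ_)

  Below : Pred (Carrier × Carrier) (a ⊔ ℓ)
  Below (p , q) = Lift a (p ≤ q)

  Below-resp : Below Respects CommutativeMonoid._≈_ pairs
  Below-resp (p≈p′ , q≈q′) (lift p≤q) =
    lift (≤-trans (≤-reflexive (·M.sym p≈p′)) (≤-trans p≤q (≤-reflexive q≈q′)))

  open PhaseSpace {d = ℓ} pairs Below Below-resp public
  open CIRPomonoid phaseSpace using (~_) renaming (_+_ to _⊕_)

  ⟦_⟧ : Carrier → Phase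
  ⟦ c ⟧ (p , q) = Lift a (p ≤ c + q)

  c∈⟦c⟧ : ∀ c → (c , 0#) ∈ ⟦ c ⟧
  c∈⟦c⟧ c = lift (≤-reflexive (+M.sym (+M.identityʳ c)))

  ⟦⟧≐[1,c]ᗮ : ∀ c → ⟦ c ⟧ ≐ [ (1# , c) ] ᗮ
  ⟦⟧≐[1,c]ᗮ c =
    (λ { (lift p≤c+q) (lift refl) → lift (≤-trans (≤-reflexive (·M.identityˡ _)) p≤c+q) }) ,
    (λ m∈ → lift (≤-trans (≤-reflexive (·M.sym (·M.identityˡ _))) (lower (m∈ (lift refl)))))

  ⟦⟧ᗮ≐[c,0]ᗮ : ∀ c → ⟦ c ⟧ ᗮ ≐ [ (c , 0#) ] ᗮ
  ⟦⟧ᗮ≐[c,0]ᗮ c =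
    (λ { z∈ (lift refl) → z∈ (c∈⟦c⟧ c) }) ,
    (λ z∈ (lift p≤c+q) →
      lift (cut p≤c+q (≤-trans (lower (z∈ (lift refl))) (≤-reflexive (+M.identityˡ _)))))

  [1,c]∈⟦c⟧ᗮ : ∀ c → (1# , c) ∈ ⟦ c ⟧ ᗮ
  [1,c]∈⟦c⟧ᗮ c = ᗮ-antitone (proj₁ (⟦⟧≐[1,c]ᗮ c)) (⊆ᗮᗮ (lift refl))

  ⟦⟧≈ᴾ[c,0] : ∀ c → ⟦ c ⟧ ≈ᴾ [ (c , 0#) ]
  ⟦⟧≈ᴾ[c,0] c = lift (⟦⟧ᗮ≐[c,0]ᗮ c)

  ⟦⟧ᗮ≈ᴾ[1,c] : ∀ c → ⟦ c ⟧ ᗮ ≈ᴾ [ (1# , c) ]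
  ⟦⟧ᗮ≈ᴾ[1,c] c = Setoid.trans ≈ᴾ-setoid (ᗮ-congᴾ (≐⇒≈ᴾ (⟦⟧≐[1,c]ᗮ c))) ᗮᗮ≈ᴾ

  ⟦⟧-mono : ∀ {x y} → x ≤ y → ⟦ x ⟧ ≤ᴾ ⟦ y ⟧
  ⟦⟧-mono x≤y = lift (ᗮ-antitone λ (lift p≤x+q) → lift (≤-trans p≤x+q (+.mono x≤y ≤-refl)))

  ⟦⟧-reflects-≤ : ∀ {x y} → ⟦ x ⟧ ≤ᴾ ⟦ y ⟧ → x ≤ y
  ⟦⟧-reflects-≤ {x} {y} (lift ⟦y⟧ᗮ⊆⟦x⟧ᗮ) = begin
    x      ≈⟨ ·M.identityʳ x ⟨
    x · 1# ≤⟨ lower (⟦y⟧ᗮ⊆⟦x⟧ᗮ ([1,c]∈⟦c⟧ᗮ y) (c∈⟦c⟧ x)) ⟩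
    0# + y ≈⟨ +M.identityˡ y ⟩
    y      ∎
    where open ≤-Reasoning poset

  module _ where
    open ≈-Reasoning ≈ᴾ-setoid
    open IsCommutativeMonoid ⊗-isCommutativeMonoid using () renaming (∙-cong to ⊗-cong)

    ⟦⟧-· : ∀ x y → ⟦ x · y ⟧ ≈ᴾ ⟦ x ⟧ ⊗ ⟦ y ⟧
    ⟦⟧-· x y = begin
      ⟦ x · y ⟧                    ≈⟨ ⟦⟧≈ᴾ[c,0] (x · y) ⟩
      [ (x · y , 0#) ]             ≈⟨ []-cong (·M.refl , +M.sym (+M.identityˡ 0#)) ⟩
      [ (x · y , 0# + 0#) ]        ≈⟨ []-⊗ ⟨
      [ (x , 0#) ] ⊗ [ (y , 0#) ]  ≈⟨ ⊗-cong (⟦⟧≈ᴾ[c,0] x) (⟦⟧≈ᴾ[c,0] y) ⟨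
      ⟦ x ⟧ ⊗ ⟦ y ⟧                ∎

    ⟦⟧-+ : ∀ x y → ⟦ x + y ⟧ ≈ᴾ ⟦ x ⟧ ⊕ ⟦ y ⟧
    ⟦⟧-+ x y = begin
      ⟦ x + y ⟧                          ≈⟨ ≐⇒≈ᴾ (⟦⟧≐[1,c]ᗮ (x + y)) ⟩
      [ (1# , x + y) ] ᗮ                 ≈⟨ ᗮ-congᴾ ([]-cong (·M.sym (·M.identityˡ 1#) , +M.refl)) ⟩
      [ (1# · 1# , x + y) ] ᗮ            ≈⟨ ᗮ-congᴾ []-⊗ ⟨
      ([ (1# , x) ] ⊗ [ (1# , y) ]) ᗮ    ≈⟨ ᗮ-congᴾ (⊗-cong (⟦⟧ᗮ≈ᴾ[1,c] x) (⟦⟧ᗮ≈ᴾ[1,c] y)) ⟨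
      (⟦ x ⟧ ᗮ ⊗ ⟦ y ⟧ ᗮ) ᗮ              ≈⟨ ᗮ-congᴾ (⊗-cong ⊸⊥≈ᴾᗮ ⊸⊥≈ᴾᗮ) ⟨
      (~ ⟦ x ⟧ ⊗ ~ ⟦ y ⟧) ᗮ              ≈⟨ ⊸⊥≈ᴾᗮ ⟨
      ⟦ x ⟧ ⊕ ⟦ y ⟧                      ∎

  ⟦⟧-0 : ⟦ 0# ⟧ ≈ᴾ Below
  ⟦⟧-0 = ≐⇒≈ᴾ
    ( (λ (lift h) → lift (≤-trans h (≤-reflexive (+M.identityˡ _))))
    , (λ (lift h) → lift (≤-trans h (≤-reflexive (+M.sym (+M.identityˡ _))))))

  embedding : Embedding A phaseSpace
  embedding = record
    { f = ⟦_⟧ ; orderPres = ⟦⟧-mono ; orderRefl = ⟦⟧-reflects-≤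
    ; pres-· = ⟦⟧-· ; pres-1 = ⟦⟧≈ᴾ[c,0] 1# ; pres-+ = ⟦⟧-+ ; pres-0 = ⟦⟧-0 }

  ×ᴹ≡^,×· : ∀ n p q → n ×ᴹ (p , q) ≡ (p ^ n , n ×· q)
  ×ᴹ≡^,×· zero     p q = refl
  ×ᴹ≡^,×· (1+ n) p q rewrite ×ᴹ≡^,×· n p q = refl

  Below-absorbs-power : ∀ n → (∀ x → x ≤ x ^ n × n ×· x ≤ x) →
                        ∀ m z → Below (n ×ᴹ m ∙ᴹ z) → Below (m ∙ᴹ z)
  Below-absorbs-power n sat (p , q) (r , s) below rewrite ×ᴹ≡^,×· n p q =
    lift (≤-trans (·.mono (proj₁ (sat p)) ≤-refl)
           (≤-trans (lower below) (+.mono (proj₂ (sat q)) ≤-refl)))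

  phaseSpace-satisfies : ∀ N → SatisfiesBimonoid N A → SatisfiesCIRP N phaseSpace
  phaseSpace-satisfies N sat n n∈N = ^-increasing n (Below-absorbs-power n (sat n n∈N))

satisfies⇒subreduct : ∀ {a ℓ} (N : ℕ → Set) (A : CommBimonoid a ℓ) →
                      SatisfiesBimonoid N A → IsSubreductAt (suc (a ⊔ ℓ)) (suc (a ⊔ ℓ)) N A
satisfies⇒subreduct N A sat = phaseSpace , phaseSpace-satisfies N sat , embedding
  where open BimonoidPhaseSpace A

mainTheorem19 : (N : ℕ → Set) → (∀ n → N n → n ≥ 1) →
    ∀ {a ℓ} (A : CommBimonoid a ℓ) → ∀ b ℓ' →
    (IsSubreductAt b ℓ' N A → SatisfiesBimonoid N A)
    × (SatisfiesBimonoid N A → IsSubreductAt (suc (a ⊔ ℓ)) (suc (a ⊔ ℓ)) N A)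
mainTheorem19 N _ A b ℓ' = subreduct⇒satisfies N A , satisfies⇒subreduct N A
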